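{- Let $a,k,q$ be nonzero and generic (no denominator below vanishes). Suppose sequences $(A_n)_{n\ge0}$, $(B_n)_{n\ge0}$ satisfy $A_0=1$ and, for all $n\ge0$, \[ B_n=\sum_{j=0}^{n}\frac{(a/k;q^{ -1})_{n-j}(k^{ -1};q^{ -1})_{n+j}}{(q^{ -1};q^{ -1})_{n-j}(a^{ -1}q^{ -1};q^{ -1})_{n+j}}A_j, \] i.e. $(A_n,B_n)$ is a WP-Bailey pair relative to $1/a,1/k$ in base $1/q$. Then $\left(A_n,\left(\frac{k}{aq}\right)^{2n}B_n\right)$ is a WP-Bailey pair relative to $a,k$ in base $q$. In particular, if $(\bm\alpha_n(a,k,q),\bm\beta_n(a,k,q))$ is a WP-Bailey pair for all (generic) $a,k,q$, then so is $(\bm\alpha_n(1/a,1/k,1/q),(k/(aq))^{2n}\bm\beta_n(1/a,1/k,1/q))$.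
   Context: For $n\ge0$ and any nonzero $p$, $(x;p)_n=\prod_{i=0}^{n-1}(1-xp^i)$ and $(x_1,\dots,x_j;p)_n=(x_1;p)_n\cdots(x_j;p)_n$. A pair of sequences $(\bm\alpha_n,\bm\beta_n)_{n\ge0}$ is a WP-Bailey pair relative to $a,k$ in base $p$ if $\bm\alpha_0=1$ and for all $n\ge0$, $\bm\beta_n=\sum_{j=0}^{n}\frac{(k/a;p)_{n-j}(k;p)_{n+j}}{(p;p)_{n-j}(ap;p)_{n+j}}\bm\alpha_j$. -}

module Defs where

open import Level using (_⊔_; suc)
open import Algebra.Bundles using (CommutativeRing)
open import Data.Nat using (ℕ; zero; _∸_) renaming (suc to sucℕ; _+_ to _+ℕ_; _*_ to _*ℕ_)
open import Data.Product using (_×_)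
open import Relation.Nullary using (¬_)

record Field (c ℓ : Level.Level) : Set (Level.suc (c ⊔ ℓ)) where
  field
    commutativeRing : CommutativeRing c ℓ
  open CommutativeRing commutativeRing public
  field
    _⁻¹      : Carrier → Carrier
    ⁻¹-cong  : ∀ {x y} → x ≈ y → x ⁻¹ ≈ y ⁻¹
    inverseʳ : ∀ x → ¬ (x ≈ 0#) → x * (x ⁻¹) ≈ 1#
    1≉0      : ¬ (1# ≈ 0#)
  infix 8 _⁻¹

module FieldOps {c ℓ} (F : Field c ℓ) where
  open Field F hiding (zero)

  infixl 7 _/_
  _/_ : Carrier → Carrier → Carrier
  x / y = x * (y ⁻¹)

  infixl 6 _−_
  _−_ : Carrier → Carrier → Carrier
  x − y = x + (- y)

  pow : Carrier → ℕ → Carrier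
  pow x zero = 1#
  pow x (sucℕ n) = pow x n * x

  poch : Carrier → Carrier → ℕ → Carrier
  poch x p zero = 1#
  poch x p (sucℕ n) = poch x p n * (1# − x * pow p n)

  sumTo : (ℕ → Carrier) → ℕ → Carrier
  sumTo f zero = f zero
  sumTo f (sucℕ n) = sumTo f n + f (sucℕ n)

  IsWPBailey : Carrier → Carrier → Carrier → (ℕ → Carrier) → (ℕ → Carrier) → Set ℓ
  IsWPBailey a k p α β =
    (α 0 ≈ 1#) ×
    (∀ n → β n ≈ sumTo (λ j →
        ((poch (k / a) p (n ∸ j) * poch k p (n +ℕ j))
          / (poch p p (n ∸ j) * poch (a * p) p (n +ℕ j))) * α j) n)

{-# OPTIONS --safe #-}
-- Each factor of (X; Q)_m with Q = 1/q, X = 1/x is 1 − X Q^i = (−X Q^i)(1 − x q^i), so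
-- (X; Q)_m = X^m · ∏_{i<m} (−Q^i) · (x; q)_m. In a quotient of two such products of equal
-- length the sign-and-power factor cancels, leaving (X/Y)^m. The kernel coefficient for
-- (1/a, 1/k, 1/q) is a product of two such quotients, of lengths n − j and n + j, so it is
-- (aq/k)^{(n−j)+(n+j)} = (aq/k)^{2n} times the one for (a, k, q), independently of j.
module Submission where

open import Defs
open import Data.Nat using (ℕ; zero; suc; _≤_; z≤n; _∸_) renaming (_+_ to _+ℕ_; _*_ to _*ℕ_)
import Data.Nat.Properties as ℕ
open import Data.Product using (_,_)
open import Relation.Nullary using (¬_)
open import Relation.Binary.PropositionalEquality using (_≡_; cong; module ≡-Reasoning)

2*n≡[n∸j]+[n+j] : ∀ {n j} → j ≤ n → 2 *ℕ n ≡ (n ∸ j) +ℕ (n +ℕ j)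
2*n≡[n∸j]+[n+j] {n} {j} j≤n = begin
  2 *ℕ n              ≡⟨ cong (n +ℕ_) (ℕ.+-identityʳ n) ⟩
  n +ℕ n              ≡⟨ cong (_+ℕ n) (ℕ.m∸n+n≡m j≤n) ⟨
  (n ∸ j) +ℕ j +ℕ n   ≡⟨ ℕ.+-assoc (n ∸ j) j n ⟩
  (n ∸ j) +ℕ (j +ℕ n) ≡⟨ cong ((n ∸ j) +ℕ_) (ℕ.+-comm j n) ⟩
  (n ∸ j) +ℕ (n +ℕ j) ∎
  where open ≡-Reasoning

module WPBaileyReciprocal {c ℓ} (F : Field c ℓ) where
  open Field F hiding (zero)
  open FieldOps F
  open import Relation.Binary.Reasoning.Setoid setoid
  open import Algebra.Properties.Ring ring using (-‿distribˡ-*; -‿distribʳ-*; -‿involutive)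
  open import Algebra.Solver.CommutativeMonoid *-commutativeMonoid
    using (solve; _⊕_; _⊜_) renaming (id to ι)

  *-≉0 : ∀ {x y} → ¬ (x ≈ 0#) → ¬ (y ≈ 0#) → ¬ (x * y ≈ 0#)
  *-≉0 {x} {y} x≉0 y≉0 xy≈0 = x≉0 (begin
    x                ≈⟨ *-identityʳ x ⟨
    x * 1#           ≈⟨ *-congˡ (inverseʳ y y≉0) ⟨
    x * (y * y ⁻¹)   ≈⟨ *-assoc x y (y ⁻¹) ⟨
    (x * y) * y ⁻¹   ≈⟨ *-congʳ xy≈0 ⟩
    0# * y ⁻¹        ≈⟨ zeroˡ _ ⟩
    0#               ∎)

  *≈1⇒≉0 : ∀ {x y} → x * y ≈ 1# → ¬ (x ≈ 0#)
  *≈1⇒≉0 {x} {y} xy≈1 x≈0 = 1≉0 (trans (sym xy≈1) (trans (*-congʳ x≈0) (zeroˡ y)))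

  ⁻¹-unique : ∀ {x y} → x * y ≈ 1# → y ≈ x ⁻¹
  ⁻¹-unique {x} {y} xy≈1 = begin
    y                    ≈⟨ *-identityˡ y ⟨
    1# * y               ≈⟨ *-congʳ (inverseʳ x (*≈1⇒≉0 xy≈1)) ⟨
    (x * x ⁻¹) * y       ≈⟨ solve 3 (λ x x' y → (x ⊕ x') ⊕ y ⊜ x' ⊕ (x ⊕ y)) refl x (x ⁻¹) y ⟩
    x ⁻¹ * (x * y)       ≈⟨ *-congˡ xy≈1 ⟩
    x ⁻¹ * 1#            ≈⟨ *-identityʳ _ ⟩
    x ⁻¹                 ∎

  *-inverses : ∀ {x X y Y} → x * X ≈ 1# → y * Y ≈ 1# → (x * y) * (X * Y) ≈ 1#
  *-inverses {x} {X} {y} {Y} xX≈1 yY≈1 = begin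
    (x * y) * (X * Y)   ≈⟨ solve 4 (λ x X y Y → (x ⊕ y) ⊕ (X ⊕ Y) ⊜ (x ⊕ X) ⊕ (y ⊕ Y)) refl x X y Y ⟩
    (x * X) * (y * Y)   ≈⟨ *-cong xX≈1 yY≈1 ⟩
    1# * 1#             ≈⟨ *-identityˡ 1# ⟩
    1#                  ∎

  cross-multiply : ∀ {s X Y X′ Y′} → ¬ (Y ≈ 0#) → ¬ (Y′ ≈ 0#) →
                   s * X * Y′ ≈ X′ * Y → s * (X / Y) ≈ X′ / Y′
  cross-multiply {s} {X} {Y} {X′} {Y′} Y≉0 Y′≉0 cross = begin
    s * (X * Y ⁻¹)                       ≈⟨ *-identityʳ _ ⟨
    s * (X * Y ⁻¹) * 1#                  ≈⟨ *-congˡ (inverseʳ Y′ Y′≉0) ⟨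
    s * (X * Y ⁻¹) * (Y′ * Y′ ⁻¹)        ≈⟨ solve 5 (λ s X Y' Y′ Y′' → (s ⊕ (X ⊕ Y')) ⊕ (Y′ ⊕ Y′') ⊜ ((s ⊕ X) ⊕ Y′) ⊕ (Y' ⊕ Y′')) refl s X (Y ⁻¹) Y′ (Y′ ⁻¹) ⟩
    (s * X * Y′) * (Y ⁻¹ * Y′ ⁻¹)        ≈⟨ *-congʳ cross ⟩
    (X′ * Y) * (Y ⁻¹ * Y′ ⁻¹)            ≈⟨ solve 4 (λ X′ Y Y' Y′' → (X′ ⊕ Y) ⊕ (Y' ⊕ Y′') ⊜ (Y ⊕ Y') ⊕ (X′ ⊕ Y′')) refl X′ Y (Y ⁻¹) (Y′ ⁻¹) ⟩
    (Y * Y ⁻¹) * (X′ * Y′ ⁻¹)            ≈⟨ *-congʳ (inverseʳ Y Y≉0) ⟩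
    1# * (X′ * Y′ ⁻¹)                    ≈⟨ *-identityˡ _ ⟩
    X′ * Y′ ⁻¹                           ∎

  -x*-y≈x*y : ∀ x y → - x * - y ≈ x * y
  -x*-y≈x*y x y = begin
    - x * - y      ≈⟨ -‿distribˡ-* x (- y) ⟨
    - (x * - y)    ≈⟨ -‿cong (-‿distribʳ-* x y) ⟨
    - - (x * y)    ≈⟨ -‿involutive _ ⟩
    x * y          ∎

  pow-cong : ∀ {x y} m → x ≈ y → pow x m ≈ pow y m
  pow-cong zero    x≈y = refl
  pow-cong (suc m) x≈y = *-cong (pow-cong m x≈y) x≈y

  pow-+ : ∀ x m n → pow x (m +ℕ n) ≈ pow x m * pow x n
  pow-+ x zero    n = sym (*-identityˡ _)
  pow-+ x (suc m) n = trans (*-congʳ (pow-+ x m n))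
    (solve 3 (λ a b x → (a ⊕ b) ⊕ x ⊜ (a ⊕ x) ⊕ b) refl (pow x m) (pow x n) x)

  pow-distrib-* : ∀ x y m → pow x m * pow y m ≈ pow (x * y) m
  pow-distrib-* x y zero    = *-identityˡ _
  pow-distrib-* x y (suc m) = trans
    (solve 4 (λ a b x y → (a ⊕ x) ⊕ (b ⊕ y) ⊜ (a ⊕ b) ⊕ (x ⊕ y)) refl (pow x m) (pow y m) x y)
    (*-congʳ (pow-distrib-* x y m))

  pow-inverses : ∀ {x y} → x * y ≈ 1# → ∀ m → pow x m * pow y m ≈ 1#
  pow-inverses xy≈1 zero    = *-identityˡ 1#
  pow-inverses xy≈1 (suc m) = *-inverses (pow-inverses xy≈1 m) xy≈1

  reflectionFactor : Carrier → ℕ → Carrier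
  reflectionFactor Q zero    = 1#
  reflectionFactor Q (suc m) = reflectionFactor Q m * - pow Q m

  poch-reciprocal : ∀ {X x Q q} → Q * q ≈ 1# → X * x ≈ 1# → ∀ m →
                    poch X Q m ≈ pow X m * reflectionFactor Q m * poch x q m
  poch-reciprocal Qq≈1 Xx≈1 zero = sym (trans (*-identityʳ _) (*-identityʳ 1#))
  poch-reciprocal {X} {x} {Q} {q} Qq≈1 Xx≈1 (suc m) = begin
    poch X Q m * (1# − X * R)
      ≈⟨ *-cong (poch-reciprocal Qq≈1 Xx≈1 m) factor ⟩
    pow X m * σ * poch x q m * (X * - R * (1# − x * S))
      ≈⟨ solve 6 (λ p σ P X R′ F → ((p ⊕ σ) ⊕ P) ⊕ ((X ⊕ R′) ⊕ F) ⊜ ((p ⊕ X) ⊕ (σ ⊕ R′)) ⊕ (P ⊕ F))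
           refl (pow X m) σ (poch x q m) X (- R) (1# − x * S) ⟩
    pow X m * X * (σ * - R) * (poch x q m * (1# − x * S)) ∎
    where
    R = pow Q m
    S = pow q m
    σ = reflectionFactor Q m
    factor : 1# − X * R ≈ X * - R * (1# − x * S)
    factor = sym (begin
      X * - R * (1# − x * S)           ≈⟨ *-congʳ (-‿distribʳ-* X R) ⟨
      - (X * R) * (1# − x * S)         ≈⟨ distribˡ (- (X * R)) 1# (- (x * S)) ⟩
      - (X * R) * 1# + - (X * R) * - (x * S)
                                       ≈⟨ +-cong (*-identityʳ _) (-x*-y≈x*y (X * R) (x * S)) ⟩
      - (X * R) + (X * R) * (x * S)    ≈⟨ +-congˡ (solve 4 (λ X R x S → (X ⊕ R) ⊕ (x ⊕ S) ⊜ (X ⊕ x) ⊕ (R ⊕ S)) refl X R x S) ⟩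
      - (X * R) + (X * x) * (R * S)    ≈⟨ +-congˡ (*-cong Xx≈1 (pow-inverses Qq≈1 m)) ⟩
      - (X * R) + 1# * 1#              ≈⟨ +-congˡ (*-identityˡ 1#) ⟩
      - (X * R) + 1#                   ≈⟨ +-comm _ _ ⟩
      1# − X * R                       ∎)

  poch-quotient-reciprocal : ∀ {X x Y y Q q s} → Q * q ≈ 1# → X * x ≈ 1# → Y * y ≈ 1# →
                             s * X ≈ Y → ∀ m →
                             pow s m * poch X Q m * poch y q m ≈ poch Y Q m * poch x q m
  poch-quotient-reciprocal {X} {x} {Y} {y} {Q} {q} {s} Qq≈1 Xx≈1 Yy≈1 sX≈Y m = begin
    pow s m * poch X Q m * poch y q m
      ≈⟨ *-congʳ (*-congˡ (poch-reciprocal Qq≈1 Xx≈1 m)) ⟩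
    pow s m * (pow X m * σ * poch x q m) * poch y q m
      ≈⟨ solve 5 (λ s X σ Px Py → (s ⊕ ((X ⊕ σ) ⊕ Px)) ⊕ Py ⊜ ((s ⊕ X) ⊕ σ) ⊕ (Py ⊕ Px))
           refl (pow s m) (pow X m) σ (poch x q m) (poch y q m) ⟩
    pow s m * pow X m * σ * (poch y q m * poch x q m)
      ≈⟨ *-congʳ (*-congʳ (trans (pow-distrib-* s X m) (pow-cong m sX≈Y))) ⟩
    pow Y m * σ * (poch y q m * poch x q m)
      ≈⟨ *-assoc _ _ _ ⟨
    pow Y m * σ * poch y q m * poch x q m
      ≈⟨ *-congʳ (poch-reciprocal Qq≈1 Yy≈1 m) ⟨
    poch Y Q m * poch x q m ∎
    where
    σ = reflectionFactor Q m

  sumTo-scale : ∀ s f g n → (∀ j → j ≤ n → s * f j ≈ g j) → s * sumTo f n ≈ sumTo g n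
  sumTo-scale s f g zero    sf≈g = sf≈g 0 z≤n
  sumTo-scale s f g (suc n) sf≈g = trans (distribˡ s (sumTo f n) (f (suc n)))
    (+-cong (sumTo-scale s f g n (λ j j≤n → sf≈g j (ℕ.m≤n⇒m≤1+n j≤n))) (sf≈g (suc n) ℕ.≤-refl))

  -- The coefficient of α_j in β_n, indexed by u = n − j and v = n + j.
  wpKernel : Carrier → Carrier → Carrier → ℕ → ℕ → Carrier
  wpKernel a k p u v = (poch (k / a) p u * poch k p v) / (poch p p u * poch (a * p) p v)

  module _ {a A k K q Q : Carrier} (aA≈1 : a * A ≈ 1#) (kK≈1 : k * K ≈ 1#) (qQ≈1 : q * Q ≈ 1#) where

    private
      Aa≈1 : A * a ≈ 1#
      Aa≈1 = trans (*-comm A a) aA≈1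

      A⁻¹≈a : A ⁻¹ ≈ a
      A⁻¹≈a = sym (⁻¹-unique Aa≈1)

      [aq]⁻¹≈AQ : (a * q) ⁻¹ ≈ A * Q
      [aq]⁻¹≈AQ = sym (⁻¹-unique (*-inverses aA≈1 qQ≈1))

      k[aq]⁻¹K≈AQ : k * (a * q) ⁻¹ * K ≈ A * Q
      k[aq]⁻¹K≈AQ = begin
        k * (a * q) ⁻¹ * K     ≈⟨ solve 3 (λ k I K → (k ⊕ I) ⊕ K ⊜ (k ⊕ K) ⊕ I) refl k ((a * q) ⁻¹) K ⟩
        k * K * (a * q) ⁻¹     ≈⟨ *-cong kK≈1 [aq]⁻¹≈AQ ⟩
        1# * (A * Q)           ≈⟨ *-identityˡ _ ⟩
        A * Q                  ∎

      k[aq]⁻¹[K/A]≈Q : k * (a * q) ⁻¹ * (K / A) ≈ Q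
      k[aq]⁻¹[K/A]≈Q = begin
        k * (a * q) ⁻¹ * (K * A ⁻¹)   ≈⟨ *-assoc _ K (A ⁻¹) ⟨
        k * (a * q) ⁻¹ * K * A ⁻¹     ≈⟨ *-cong k[aq]⁻¹K≈AQ A⁻¹≈a ⟩
        A * Q * a                     ≈⟨ solve 3 (λ A Q a → (A ⊕ Q) ⊕ a ⊜ (A ⊕ a) ⊕ Q) refl A Q a ⟩
        A * a * Q                     ≈⟨ *-congʳ Aa≈1 ⟩
        1# * Q                        ≈⟨ *-identityˡ Q ⟩
        Q                             ∎

      [K/A][k/a]≈1 : (K / A) * (k / a) ≈ 1#
      [K/A][k/a]≈1 = begin
        (K * A ⁻¹) * (k * a ⁻¹)   ≈⟨ *-cong (*-congˡ A⁻¹≈a) (*-congˡ (sym (⁻¹-unique aA≈1))) ⟩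
        (K * a) * (k * A)         ≈⟨ *-inverses (trans (*-comm K k) kK≈1) aA≈1 ⟩
        1#                        ∎

    wpKernel-reciprocal : ∀ u v →
      ¬ (poch q q u ≈ 0#) → ¬ (poch (a * q) q v ≈ 0#) →
      ¬ (poch Q Q u ≈ 0#) → ¬ (poch (A * Q) Q v ≈ 0#) →
      pow (k / (a * q)) (u +ℕ v) * wpKernel A K Q u v ≈ wpKernel a k q u v
    wpKernel-reciprocal u v qu≉0 aqv≉0 Qu≉0 AQv≉0 =
      cross-multiply (*-≉0 Qu≉0 AQv≉0) (*-≉0 qu≉0 aqv≉0) (begin
        pow s (u +ℕ v) * (N₁ * N₂) * (n₁ * n₂)
          ≈⟨ *-congʳ (*-congʳ (pow-+ s u v)) ⟩
        pow s u * pow s v * (N₁ * N₂) * (n₁ * n₂)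
          ≈⟨ solve 6 (λ su sv N₁ N₂ n₁ n₂ → ((su ⊕ sv) ⊕ (N₁ ⊕ N₂)) ⊕ (n₁ ⊕ n₂) ⊜ ((su ⊕ N₁) ⊕ n₁) ⊕ ((sv ⊕ N₂) ⊕ n₂))
               refl (pow s u) (pow s v) N₁ N₂ n₁ n₂ ⟩
        (pow s u * N₁ * n₁) * (pow s v * N₂ * n₂)
          ≈⟨ *-cong (poch-quotient-reciprocal Qq≈1 [K/A][k/a]≈1 Qq≈1 k[aq]⁻¹[K/A]≈Q u)
                    (poch-quotient-reciprocal Qq≈1 (trans (*-comm K k) kK≈1) AQaq≈1 k[aq]⁻¹K≈AQ v) ⟩
        (D₁ * m₁) * (D₂ * m₂)
          ≈⟨ solve 4 (λ D₁ m₁ D₂ m₂ → (D₁ ⊕ m₁) ⊕ (D₂ ⊕ m₂) ⊜ (m₁ ⊕ m₂) ⊕ (D₁ ⊕ D₂)) refl D₁ m₁ D₂ m₂ ⟩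
        (m₁ * m₂) * (D₁ * D₂) ∎)
      where
      s  = k / (a * q)
      N₁ = poch (K / A) Q u
      N₂ = poch K Q v
      D₁ = poch Q Q u
      D₂ = poch (A * Q) Q v
      m₁ = poch (k / a) q u
      m₂ = poch k q v
      n₁ = poch q q u
      n₂ = poch (a * q) q v
      Qq≈1 : Q * q ≈ 1#
      Qq≈1 = trans (*-comm Q q) qQ≈1
      AQaq≈1 : (A * Q) * (a * q) ≈ 1#
      AQaq≈1 = *-inverses Aa≈1 Qq≈1

    wpBailey-reciprocal :
      (∀ m → ¬ (poch q q m ≈ 0#)) → (∀ m → ¬ (poch (a * q) q m ≈ 0#)) →
      (∀ m → ¬ (poch Q Q m ≈ 0#)) → (∀ m → ¬ (poch (A * Q) Q m ≈ 0#)) →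
      (α β : ℕ → Carrier) → IsWPBailey A K Q α β →
      IsWPBailey a k q α (λ n → pow (k / (a * q)) (2 *ℕ n) * β n)
    wpBailey-reciprocal qq≉0 aqq≉0 QQ≉0 AQQ≉0 α β (α₀≈1 , β≈) = α₀≈1 , λ n →
      trans (*-congˡ (β≈ n)) (sumTo-scale _ _ _ n (rescaled-term n))
      where
      s = k / (a * q)
      rescaled-term : ∀ n j → j ≤ n →
        pow s (2 *ℕ n) * (wpKernel A K Q (n ∸ j) (n +ℕ j) * α j) ≈ wpKernel a k q (n ∸ j) (n +ℕ j) * α j
      rescaled-term n j j≤n = trans (sym (*-assoc _ _ _)) (*-congʳ (begin
        pow s (2 *ℕ n) * wpKernel A K Q u v       ≈⟨ *-congʳ (reflexive (cong (pow s) (2*n≡[n∸j]+[n+j] j≤n))) ⟩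
        pow s (u +ℕ v) * wpKernel A K Q u v       ≈⟨ wpKernel-reciprocal u v (qq≉0 u) (aqq≉0 v) (QQ≉0 u) (AQQ≉0 v) ⟩
        wpKernel a k q u v                        ∎))
        where
        u = n ∸ j
        v = n +ℕ j

mainTheorem6 : ∀ {c ℓ} (F : Field c ℓ) →
    let open Field F
        open FieldOps F
    in (a k q : Carrier) →
       ¬ (a ≈ 0#) → ¬ (k ≈ 0#) → ¬ (q ≈ 0#) →
       (∀ m → ¬ (poch q q m ≈ 0#)) →
       (∀ m → ¬ (poch (a * q) q m ≈ 0#)) →
       (∀ m → ¬ (poch (q ⁻¹) (q ⁻¹) m ≈ 0#)) →
       (∀ m → ¬ (poch ((a ⁻¹) * (q ⁻¹)) (q ⁻¹) m ≈ 0#)) →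
       (A B : ℕ → Carrier) →
       IsWPBailey (a ⁻¹) (k ⁻¹) (q ⁻¹) A B →
       IsWPBailey a k q A (λ n → pow (k / (a * q)) (2 *ℕ n) * B n)
mainTheorem6 F a k q a≉0 k≉0 q≉0 =
  wpBailey-reciprocal (inverseʳ a a≉0) (inverseʳ k k≉0) (inverseʳ q q≉0)
  where
  open Field F using (inverseʳ)
  open WPBaileyReciprocal F using (wpBailey-reciprocal)
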